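{- Let $G$ be a finite graph, let $X=\{x_1,\dots,x_k\}$ be its set of degree-1 vertices, and let $k_2$ be the number of degree-2 vertices of $G$. Then it is possible to perform a sequence of 1-reductions in $G$ such that each vertex $x_i\in X$ either is matched, one-to-one, with a good 1-reduction in this sequence, or belongs to a connected component of $G$ containing at least one other vertex of $X$; moreover the total number of vertices in all such components (those containing unmatched vertices of $X$) is at most $2k+k_2$.
   Context: A 1-reduction on a degree-1 vertex $v$ deletes $v$ and its incident edge, decreasing the degree of its neighbor $w$ by one; it is good if $w$ had degree at least $3$ before the reduction. Degrees are taken in the current graph as the sequence proceeds. -}

module Defs where

open import Data.Nat using (ℕ; zero; suc; _+_; _*_; _≤_)
open import Data.Nat.Properties using (_≟_)
open import Data.Bool using (Bool; true; false; _∧_; not; if_then_else_)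
open import Data.Fin using (Fin; toℕ)
import Data.Fin.Properties as FinP
open import Data.List using (List; []; _∷_; length; map; allFin; filter; lookup; take)
open import Data.Nat.ListAction using (sum)
open import Data.Bool.ListAction using (any)
open import Data.List.Membership.Propositional using (_∈_)
open import Data.Maybe using (Maybe; just; nothing)
open import Data.Product using (Σ; ∃; _×_; _,_)
open import Relation.Nullary using (¬_)
open import Relation.Nullary.Decidable using (⌊_⌋)
open import Relation.Binary.PropositionalEquality using (_≡_)

record Graph (n : ℕ) : Set where
  field
    adj     : Fin n → Fin n → Bool
    adj-sym : ∀ u v → adj u v ≡ adj v u
    adj-irr : ∀ v → adj v v ≡ false
open Graph public

module _ {n : ℕ} (G : Graph n) where

  degIn : (Fin n → Bool) → Fin n → ℕ
  degIn S v = sum (map (λ w → if S w ∧ adj G v w then 1 else 0) (allFin n))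

  deg : Fin n → ℕ
  deg v = degIn (λ _ → true) v

  numDeg : ℕ → ℕ
  numDeg d = length (filter (λ v → deg v ≟ d) (allFin n))

  data Connected : Fin n → Fin n → Set where
    here : ∀ {v} → Connected v v
    step : ∀ {u v w} → adj G u v ≡ true → Connected v w → Connected u w

alive : {n : ℕ} → List (Fin n) → Fin n → Bool
alive rs v = not (any (λ u → ⌊ u FinP.≟ v ⌋) rs)

module _ {n : ℕ} (G : Graph n) (vs : List (Fin n)) where

  -- current graph just before the i-th reduction (vertices of the first i deleted)
  stateBefore : Fin (length vs) → Fin n → Bool
  stateBefore i = alive (take (toℕ i) vs)

  IsReductionSeq : Set
  IsReductionSeq = ∀ (i : Fin (length vs)) →
    (stateBefore i (lookup vs i) ≡ true) × (degIn G (stateBefore i) (lookup vs i) ≡ 1)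

  GoodAt : Fin (length vs) → Set
  GoodAt i = Σ (Fin n) λ w →
    (stateBefore i w ≡ true) × (adj G (lookup vs i) w ≡ true) × (3 ≤ degIn G (stateBefore i) w)

-- Process the leaves one at a time. From a leaf x that is still present, keep deleting the current
-- end h of the path peeled off from x, and look at the neighbour w of h: if w has degree ≥ 3 the
-- reduction is good and is matched with x; if w has degree 2 it becomes the new end and the walk
-- goes on; if w has degree 1 then h – w is an isolated edge, x stays unmatched, and its component
-- holds another leaf (w itself, or the leaf whose earlier walk removed another neighbour of w).
-- A vertex of degree ≥ 3 only drops below 3 through a good reduction aimed at it, so inside the
-- component of an unmatched leaf every such vertex is the target of a matched reduction. Hence
-- these components lie within the k leaves, the k₂ vertices of degree 2 and at most k targets.
module Submission where

open import Defs
open import Data.Nat using (ℕ; zero; suc; _+_; _*_; _≤_; _<_; z≤n; s≤s; _≟_)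
open import Data.Nat.Properties
open import Data.Bool using (Bool; true; false; _∧_; not; if_then_else_)
open import Data.Bool.Properties using (∧-zeroʳ; ∧-identityʳ; not-injective) renaming (_≟_ to _≟ᵇ_)
open import Data.Fin using (Fin; zero; suc; toℕ)
import Data.Fin.Properties as Fin
open import Data.List using (List; []; _∷_; _++_; _∷ʳ_; length; map; allFin; filter; lookup; take; tabulate)
open import Data.List.Properties using (map-tabulate; ∷-injective; ++-assoc; length-++; length-map)
open import Data.List.Relation.Unary.All using (All; []; _∷_)
open import Data.List.Relation.Unary.All.Properties using (all-filter)
open import Data.List.Relation.Unary.Any using (Any; here; there; any?)
open import Data.List.Membership.Propositional using (_∈_; find)
open import Data.List.Membership.Propositional.Properties using (∈-filter⁺; ∈-allFin; ∈-++⁺ˡ; ∈-++⁺ʳ)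
open import Data.Nat.ListAction using (sum)
open import Data.Maybe using (Maybe; just; nothing)
open import Data.Maybe.Properties using (just-injective)
open import Data.Product using (Σ; ∃; _×_; _,_; proj₁; proj₂)
open import Data.Sum using (_⊎_; inj₁; inj₂; swap; fromInj₂)
open import Function using (_∘_; id)
open import Relation.Nullary using (¬_; yes; no; contradiction)
open import Relation.Nullary.Decidable using (⌊_⌋)
open import Relation.Binary.PropositionalEquality

indicator : Bool → ℕ
indicator b = if b then 1 else 0

∑ : ∀ {n} → (Fin n → ℕ) → ℕ
∑ f = sum (tabulate f)

∑-mono : ∀ {n} {f g : Fin n → ℕ} → (∀ i → f i ≤ g i) → ∑ f ≤ ∑ g
∑-mono {zero}  f≤g = z≤n
∑-mono {suc n} f≤g = +-mono-≤ (f≤g zero) (∑-mono (f≤g ∘ suc))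

∑-cong : ∀ {n} {f g : Fin n → ℕ} → (∀ i → f i ≡ g i) → ∑ f ≡ ∑ g
∑-cong {zero}  f≡g = refl
∑-cong {suc n} f≡g = cong₂ _+_ (f≡g zero) (∑-cong (f≡g ∘ suc))

∑-≥-term : ∀ {n} (f : Fin n → ℕ) i → f i ≤ ∑ f
∑-≥-term f zero    = m≤m+n _ _
∑-≥-term f (suc i) = ≤-trans (∑-≥-term (f ∘ suc) i) (m≤n+m _ _)

∑-suc-at : ∀ {n} {f g : Fin n → ℕ} i →
  (∀ j → j ≢ i → f j ≡ g j) → f i ≡ suc (g i) → ∑ f ≡ suc (∑ g)
∑-suc-at zero f≡g fi = cong₂ _+_ fi (∑-cong λ j → f≡g (suc j) λ ())
∑-suc-at {g = g} (suc i) f≡g fi =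
  trans (cong₂ _+_ (f≡g zero λ ()) (∑-suc-at i (λ j j≢i → f≡g (suc j) (j≢i ∘ Fin.suc-injective)) fi))
        (+-suc (g zero) _)

∑-indicator-pos : ∀ {n} (b : Fin n → Bool) → 1 ≤ ∑ (indicator ∘ b) → ∃ λ i → b i ≡ true
∑-indicator-pos {suc n} b pos with b zero in eq
... | true  = zero , eq
... | false = let i , bi = ∑-indicator-pos (b ∘ suc) pos in suc i , bi

indicator-∧-≤ : ∀ a b → indicator (a ∧ b) ≤ indicator b
indicator-∧-≤ true  b     = ≤-refl
indicator-∧-≤ false true  = z≤n
indicator-∧-≤ false false = z≤n

∧-true : ∀ {a b} → a ∧ b ≡ true → (a ≡ true) × (b ≡ true)
∧-true {true} {true} _ = refl , refl

false-true-≢ : ∀ {A : Set} {S : A → Bool} {a b} → S a ≡ false → S b ≡ true → a ≢ b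
false-true-≢ Sa Sb refl = contradiction (trans (sym Sa) Sb) λ ()

module _ {n : ℕ} where

  alive-∷ʳ : ∀ (xs : List (Fin n)) h v → alive (xs ∷ʳ h) v ≡ alive xs v ∧ not ⌊ h Fin.≟ v ⌋
  alive-∷ʳ [] h v with h Fin.≟ v
  ... | yes _ = refl
  ... | no  _ = refl
  alive-∷ʳ (u ∷ xs) h v with u Fin.≟ v
  ... | yes _ = refl
  ... | no  _ = alive-∷ʳ xs h v

  alive-∷ʳ-self : ∀ xs h → alive (xs ∷ʳ h) h ≡ false
  alive-∷ʳ-self xs h rewrite alive-∷ʳ xs h h with h Fin.≟ h
  ... | yes _   = ∧-zeroʳ _
  ... | no  h≢h = contradiction refl h≢h

  alive-∷ʳ-other : ∀ xs {h v} → h ≢ v → alive (xs ∷ʳ h) v ≡ alive xs v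
  alive-∷ʳ-other xs {h} {v} h≢v rewrite alive-∷ʳ xs h v with h Fin.≟ v
  ... | yes h≡v = contradiction h≡v h≢v
  ... | no  _   = ∧-identityʳ _

  alive-∷ʳ⁻ : ∀ xs {h v} → alive (xs ∷ʳ h) v ≡ true → (alive xs v ≡ true) × (h ≢ v)
  alive-∷ʳ⁻ xs {h} {v} a with h Fin.≟ v
  ... | yes refl = contradiction (trans (sym (alive-∷ʳ-self xs h)) a) λ ()
  ... | no  h≢v  = trans (sym (alive-∷ʳ-other xs h≢v)) a , h≢v

  dead-∷ʳ : ∀ xs {h v} → alive xs v ≡ false → alive (xs ∷ʳ h) v ≡ false
  dead-∷ʳ xs {h} {v} d rewrite alive-∷ʳ xs h v | d = refl

  dead-∷ʳ⁻ : ∀ xs {h v} → alive (xs ∷ʳ h) v ≡ false → (v ≡ h) ⊎ (alive xs v ≡ false)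
  dead-∷ʳ⁻ xs {h} {v} d with h Fin.≟ v
  ... | yes refl = inj₁ refl
  ... | no  h≢v  = inj₂ (trans (sym (alive-∷ʳ-other xs h≢v)) d)

module _ {A : Set} where

  Occurs : List A → A → List A → Set
  Occurs p c xs = ∃ λ rest → xs ≡ p ++ c ∷ rest

  occurs-last : ∀ xs {a} → Occurs xs a (xs ∷ʳ a)
  occurs-last xs = [] , refl

  occurs-∷ʳ : ∀ {p c xs a} → Occurs p c xs → Occurs p c (xs ∷ʳ a)
  occurs-∷ʳ {p} {c} {a = a} (rest , refl) = rest ∷ʳ a , ++-assoc p (c ∷ rest) (a ∷ [])

  occurs-∷ʳ⁻ : ∀ xs {p c a} → Occurs p c (xs ∷ʳ a) → (p ≡ xs × c ≡ a) ⊎ Occurs p c xs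
  occurs-∷ʳ⁻ []       {[]}          (rest , eq) = inj₁ (refl , sym (proj₁ (∷-injective eq)))
  occurs-∷ʳ⁻ []       {_ ∷ []}      (rest , ())
  occurs-∷ʳ⁻ []       {_ ∷ _ ∷ _}   (rest , ())
  occurs-∷ʳ⁻ (x ∷ xs) {[]}          (rest , eq) with ∷-injective eq
  ... | refl , _ = inj₂ (xs , refl)
  occurs-∷ʳ⁻ (x ∷ xs) {y ∷ p}       (rest , eq) with ∷-injective eq
  ... | refl , eq′ with occurs-∷ʳ⁻ xs (rest , eq′)
  ... | inj₁ (refl , c≡a)     = inj₁ (refl , c≡a)
  ... | inj₂ (rest′ , refl)   = inj₂ (rest′ , refl)

  occurs-length : ∀ {p c xs} → Occurs p c xs → length p < length xs
  occurs-length {p} {c} (rest , refl) rewrite length-++ p {c ∷ rest} | +-suc (length p) (length rest) =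
    s≤s (m≤m+n _ _)

  occurs-index : ∀ {p c xs} → Occurs p c xs →
    Σ (Fin (length xs)) λ i → (take (toℕ i) xs ≡ p) × (lookup xs i ≡ c)
  occurs-index {[]}    (rest , refl) = zero , refl , refl
  occurs-index {x ∷ p} (rest , refl) =
    let i , take≡ , lookup≡ = occurs-index {p} (rest , refl) in suc i , cong (x ∷_) take≡ , lookup≡

  occurs-lookup : ∀ (xs : List A) i → Occurs (take (toℕ i) xs) (lookup xs i) xs
  occurs-lookup (x ∷ xs) zero    = xs , refl
  occurs-lookup (x ∷ xs) (suc i) = let rest , eq = occurs-lookup xs i in rest , cong (x ∷_) eq

-- Degrees and connectivity in the remaining graph

module _ {n : ℕ} (G : Graph n) where

  adj-sym′ : ∀ {u v} → adj G u v ≡ true → adj G v u ≡ true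
  adj-sym′ {u} {v} e = trans (adj-sym G v u) e

  adj⇒≢ : ∀ {u v} → adj G u v ≡ true → u ≢ v
  adj⇒≢ {u} e refl = contradiction (trans (sym (adj-irr G u)) e) λ ()

  degIn-∑ : ∀ S v → degIn G S v ≡ ∑ (λ w → indicator (S w ∧ adj G v w))
  degIn-∑ S v = cong sum (map-tabulate {n = n} id (λ w → indicator (S w ∧ adj G v w)))

  degIn-≤-deg : ∀ S v → degIn G S v ≤ deg G v
  degIn-≤-deg S v rewrite degIn-∑ S v | degIn-∑ (λ _ → true) v = ∑-mono λ w → indicator-∧-≤ (S w) _

  degIn-full : ∀ S v → (∀ w → adj G v w ≡ true → S w ≡ true) → degIn G S v ≡ deg G v
  degIn-full S v full rewrite degIn-∑ S v | degIn-∑ (λ _ → true) v = ∑-cong term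
    where
    term : ∀ w → indicator (S w ∧ adj G v w) ≡ indicator (adj G v w)
    term w with adj G v w in e
    ... | true  rewrite full w e = refl
    ... | false = cong indicator (∧-zeroʳ (S w))

  degIn-pos : ∀ S {v w} → S w ≡ true → adj G v w ≡ true → 1 ≤ degIn G S v
  degIn-pos S {v} {w} Sw vw rewrite degIn-∑ S v =
    ≤-trans (≤-reflexive (cong indicator (sym (cong₂ _∧_ Sw vw)))) (∑-≥-term _ w)

  degIn-neighbour : ∀ S v → 1 ≤ degIn G S v → ∃ λ w → (S w ≡ true) × (adj G v w ≡ true)
  degIn-neighbour S v pos rewrite degIn-∑ S v =
    let w , e = ∑-indicator-pos (λ w → S w ∧ adj G v w) pos in w , ∧-true e

  degIn-missing : ∀ S v → degIn G S v ≢ deg G v → ∃ λ w → (adj G v w ≡ true) × (S w ≡ false)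
  degIn-missing S v S≢deg with Fin.any? (λ w → adj G v w ∧ not (S w) ≟ᵇ true)
  ... | yes (w , e) = let vw , not-Sw = ∧-true e in w , vw , not-injective not-Sw
  ... | no  none    = contradiction (degIn-full S v full) S≢deg
    where
    full : ∀ w → adj G v w ≡ true → S w ≡ true
    full w vw with S w in Sw
    ... | true  = refl
    ... | false = contradiction (w , cong₂ (λ a b → a ∧ not b) vw Sw) none

  degAfter : List (Fin n) → Fin n → ℕ
  degAfter pre = degIn G (alive pre)

  degAfter-∷ʳ-adj : ∀ cur {h v} → alive cur h ≡ true → adj G v h ≡ true →
    degAfter cur v ≡ suc (degAfter (cur ∷ʳ h) v)
  degAfter-∷ʳ-adj cur {h} {v} ah vh rewrite degIn-∑ (alive cur) v | degIn-∑ (alive (cur ∷ʳ h)) v =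
    ∑-suc-at h (λ w w≢h → cong (λ b → indicator (b ∧ adj G v w)) (sym (alive-∷ʳ-other cur (w≢h ∘ sym))))
      at-h
    where
    at-h : indicator (alive cur h ∧ adj G v h) ≡ suc (indicator (alive (cur ∷ʳ h) h ∧ adj G v h))
    at-h rewrite ah | vh | alive-∷ʳ-self cur h = refl

  degAfter-∷ʳ-nonadj : ∀ cur {h v} → adj G v h ≡ false → degAfter (cur ∷ʳ h) v ≡ degAfter cur v
  degAfter-∷ʳ-nonadj cur {h} {v} vh rewrite degIn-∑ (alive cur) v | degIn-∑ (alive (cur ∷ʳ h)) v =
    ∑-cong term
    where
    term : ∀ w → indicator (alive (cur ∷ʳ h) w ∧ adj G v w) ≡ indicator (alive cur w ∧ adj G v w)
    term w with h Fin.≟ w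
    ... | yes refl rewrite alive-∷ʳ-self cur h | vh | ∧-zeroʳ (alive cur h) = refl
    ... | no  h≢w  rewrite alive-∷ʳ-other cur h≢w = refl

  -- A second alive neighbour would survive the deletion of the first one.
  neighbour-unique : ∀ cur {v p q} → degAfter cur v ≡ 1 →
    alive cur p ≡ true → adj G v p ≡ true → alive cur q ≡ true → adj G v q ≡ true → p ≡ q
  neighbour-unique cur {v} {p} {q} d1 ap vp aq vq with p Fin.≟ q
  ... | yes p≡q = p≡q
  ... | no  p≢q = contradiction (≤-trans survivor (≤-reflexive gone)) λ ()
    where
    survivor : 1 ≤ degAfter (cur ∷ʳ p) v
    survivor = degIn-pos (alive (cur ∷ʳ p)) (trans (alive-∷ʳ-other cur p≢q) aq) vq
    gone : degAfter (cur ∷ʳ p) v ≡ 0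
    gone = suc-injective (trans (sym (degAfter-∷ʳ-adj cur ap vp)) d1)

  aliveCount : List (Fin n) → ℕ
  aliveCount pre = ∑ (indicator ∘ alive pre)

  aliveCount-∷ʳ : ∀ cur {h} → alive cur h ≡ true → aliveCount cur ≡ suc (aliveCount (cur ∷ʳ h))
  aliveCount-∷ʳ cur {h} ah =
    ∑-suc-at h (λ w w≢h → cong indicator (sym (alive-∷ʳ-other cur (w≢h ∘ sym))))
      at-h
    where
    at-h : indicator (alive cur h) ≡ suc (indicator (alive (cur ∷ʳ h) h))
    at-h rewrite ah | alive-∷ʳ-self cur h = refl

  aliveCount-pos : ∀ cur {h} → alive cur h ≡ true → 1 ≤ aliveCount cur
  aliveCount-pos cur {h} ah =
    ≤-trans (≤-reflexive (cong indicator (sym ah))) (∑-≥-term (indicator ∘ alive cur) h)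

  Connected-trans : ∀ {a b c} → Connected G a b → Connected G b c → Connected G a c
  Connected-trans here         q = q
  Connected-trans (step ab p) q = step ab (Connected-trans p q)

  Connected-sym : ∀ {a b} → Connected G a b → Connected G b a
  Connected-sym here         = here
  Connected-sym (step ab p) = Connected-trans (Connected-sym p) (step (adj-sym′ ab) here)

  Connected-deg-pos : ∀ {a b} → Connected G a b → 1 ≤ deg G a → 1 ≤ deg G b
  Connected-deg-pos here         pos = pos
  Connected-deg-pos (step ab p) _   = Connected-deg-pos p (degIn-pos (λ _ → true) refl (adj-sym′ ab))

  -- A path all of whose vertices, except possibly the first, lie in S.
  data PathIn (S : Fin n → Bool) : Fin n → Fin n → Set where
    here : ∀ {v} → PathIn S v v
    step : ∀ {u v w} → adj G u v ≡ true → S v ≡ true → PathIn S v w → PathIn S u w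

  ConnectedWithin : List (Fin n) → Set
  ConnectedWithin pre = ∀ {a b} → alive pre a ≡ true → alive pre b ≡ true →
    Connected G a b → PathIn (alive pre) a b

  connectedWithin-[] : ConnectedWithin []
  connectedWithin-[] _ _ = embed
    where
    embed : ∀ {a b} → Connected G a b → PathIn (alive []) a b
    embed here         = here
    embed (step ab p) = step ab refl (embed p)

  IsOneReduction : List (Fin n) → Fin n → Set
  IsOneReduction pre c = (alive pre c ≡ true) × (degAfter pre c ≡ 1)

  -- A path through a deleted leaf h enters and leaves h via its unique neighbour, so h can be skipped.
  bypass : ∀ cur h → IsOneReduction cur h → ∀ {a b} → alive cur a ≡ true → h ≢ a → h ≢ b →
    PathIn (alive cur) a b → PathIn (alive (cur ∷ʳ h)) a b
  bypass cur h r aa h≢a h≢b here = here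
  bypass cur h r aa h≢a h≢b (step {v = v} av sv p) with h Fin.≟ v
  bypass cur h r aa h≢a h≢b (step av sv here) | yes refl = contradiction refl h≢b
  bypass cur h r aa h≢a h≢b (step av sv (step hq sq p)) | yes refl =
    subst (λ z → PathIn (alive (cur ∷ʳ h)) z _)
      (neighbour-unique cur (proj₂ r) sq hq aa (adj-sym′ av))
      (bypass cur h r sq (adj⇒≢ hq) h≢b p)
  ... | no h≢v = step av (trans (alive-∷ʳ-other cur h≢v) sv) (bypass cur h r sv h≢v h≢b p)

  connectedWithin-∷ʳ : ∀ {cur h} → ConnectedWithin cur → IsOneReduction cur h → ConnectedWithin (cur ∷ʳ h)
  connectedWithin-∷ʳ {cur} {h} cw r aa ab p =
    let aa′ , h≢a = alive-∷ʳ⁻ cur aa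
        ab′ , h≢b = alive-∷ʳ⁻ cur ab
    in bypass cur h r aa′ h≢a h≢b (cw aa′ ab′ p)

  isolated-edge : ∀ pre {a b v} → alive pre a ≡ true → alive pre b ≡ true → adj G a b ≡ true →
    degAfter pre a ≡ 1 → degAfter pre b ≡ 1 → PathIn (alive pre) a v → (v ≡ a) ⊎ (v ≡ b)
  isolated-edge pre _  _  _  _  _  here = inj₁ refl
  isolated-edge pre aa ab e da db (step aq sq p) with neighbour-unique pre da sq aq ab e
  ... | refl = swap (isolated-edge pre ab aa (adj-sym′ e) db da p)

  Reduces : List (Fin n) → Set
  Reduces pre = ∀ {p c} → Occurs p c pre → IsOneReduction p c

  reduces-[] : Reduces []
  reduces-[] {[]}    (_ , ())
  reduces-[] {_ ∷ _} (_ , ())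

  reduces-∷ʳ : ∀ {cur h} → Reduces cur → IsOneReduction cur h → Reduces (cur ∷ʳ h)
  reduces-∷ʳ {cur} red r occ with occurs-∷ʳ⁻ cur occ
  ... | inj₁ (refl , refl) = r
  ... | inj₂ occ′          = red occ′

  reduces⇒isReductionSeq : ∀ {vs} → Reduces vs → IsReductionSeq G vs
  reduces⇒isReductionSeq {vs} red i = red (occurs-lookup vs i)

  -- Matching leaves with good reductions

  -- A good 1-reduction, charged to the leaf `leaf`.
  record Match : Set where
    field
      leaf         : Fin n
      leaf-deg     : deg G leaf ≡ 1
      before       : List (Fin n)
      deleted      : Fin n
      target       : Fin n
      target-alive : alive before target ≡ true
      target-adj   : adj G deleted target ≡ true
      target-deg   : 3 ≤ degAfter before target
  open Match

  MatchedIn : List Match → Fin n → Set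
  MatchedIn M x = Any (λ e → leaf e ≡ x) M

  Abandoned : List Match → Fin n → Set
  Abandoned M x =
    (Σ (Fin n) λ y → (y ≢ x) × (deg G y ≡ 1) × Connected G x y) ×
    (∀ v → Connected G x v → 3 ≤ deg G v → v ∈ map target M)

  Settled : List Match → Fin n → Set
  Settled M x = MatchedIn M x ⊎ Abandoned M x

  settled-∷ : ∀ {M x} e → Settled M x → Settled (e ∷ M) x
  settled-∷ e (inj₁ m)               = inj₁ (there m)
  settled-∷ e (inj₂ (other , cover)) = inj₂ (other , λ v xv dv → there (cover v xv dv))

  DeadLeavesSettled : List (Fin n) → List Match → Set
  DeadLeavesSettled pre M = ∀ x → deg G x ≡ 1 → alive pre x ≡ false → Settled M x

  Rooted : List (Fin n) → Fin n → Set
  Rooted pre v = Σ (Fin n) λ z → (deg G z ≡ 1) × (alive pre z ≡ false) × Connected G z v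

  record Inv (pre : List (Fin n)) (M : List Match) : Set where
    field
      reduces       : Reduces pre
      within        : ConnectedWithin pre
      leaves-intact : ∀ x → deg G x ≡ 1 → alive pre x ≡ true → degAfter pre x ≡ 1
      rooted        : ∀ v → alive pre v ≡ false → Rooted pre v
      recorded      : ∀ {e} → e ∈ M → Occurs (before e) (deleted e) pre
      distinct      : ∀ {e₁ e₂} → e₁ ∈ M → e₂ ∈ M → before e₁ ≡ before e₂ → leaf e₁ ≡ leaf e₂
      accounted     : ∀ v → 3 ≤ deg G v → (alive pre v ≡ true × 3 ≤ degAfter pre v) ⊎ v ∈ map target M

  inv-[] : Inv [] []
  inv-[] = record
    { reduces       = reduces-[]
    ; within        = connectedWithin-[]
    ; leaves-intact = λ x dx _ → dx
    ; rooted        = λ v ()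
    ; recorded      = λ ()
    ; distinct      = λ ()
    ; accounted     = λ v dv → inj₁ (refl , dv)
    }

  module LeafDeletion {cur h w} (r : IsOneReduction cur h) (w-alive : alive cur w ≡ true)
                      (hw : adj G h w ≡ true) where

    w≢h : w ≢ h
    w≢h = adj⇒≢ hw ∘ sym

    alive-w : alive (cur ∷ʳ h) w ≡ true
    alive-w = trans (alive-∷ʳ-other cur (w≢h ∘ sym)) w-alive

    degAfter-w : degAfter cur w ≡ suc (degAfter (cur ∷ʳ h) w)
    degAfter-w = degAfter-∷ʳ-adj cur (proj₁ r) (adj-sym′ hw)

    degAfter-other : ∀ {v} → alive cur v ≡ true → v ≢ w → degAfter (cur ∷ʳ h) v ≡ degAfter cur v
    degAfter-other {v} av v≢w with adj G v h in vh
    ... | true  = contradiction (neighbour-unique cur (proj₂ r) av (adj-sym′ vh) w-alive hw) v≢w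
    ... | false = degAfter-∷ʳ-nonadj cur vh

    private
      module I = Inv

    leaves-∷ʳ : ∀ {M} → Inv cur M → 2 ≤ degAfter cur w →
      ∀ x → deg G x ≡ 1 → alive (cur ∷ʳ h) x ≡ true → degAfter (cur ∷ʳ h) x ≡ 1
    leaves-∷ʳ inv w≥2 x dx ax =
      let ax′ , _ = alive-∷ʳ⁻ cur ax in trans (degAfter-other ax′ x≢w) (I.leaves-intact inv x dx ax′)
      where
      x≢w : x ≢ w
      x≢w refl = contradiction (≤-trans w≥2 (≤-trans (degIn-≤-deg _ x) (≤-reflexive dx))) λ { (s≤s ()) }

    rooted-∷ʳ : ∀ {M} → Inv cur M → Rooted (cur ∷ʳ h) h →
      ∀ v → alive (cur ∷ʳ h) v ≡ false → Rooted (cur ∷ʳ h) v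
    rooted-∷ʳ inv root-h v dv with dead-∷ʳ⁻ cur dv
    ... | inj₁ refl = root-h
    ... | inj₂ dv′  = let z , dz , az , zv = I.rooted inv v dv′ in z , dz , dead-∷ʳ cur az , zv

    accounted-∷ʳ : ∀ {M M′} → Inv cur M → (∀ {v} → v ∈ map target M → v ∈ map target M′) →
      degAfter cur w ≤ 2 ⊎ w ∈ map target M′ →
      ∀ v → 3 ≤ deg G v → (alive (cur ∷ʳ h) v ≡ true × 3 ≤ degAfter (cur ∷ʳ h) v) ⊎ v ∈ map target M′
    accounted-∷ʳ inv lift w-status v dv with I.accounted inv v dv
    ... | inj₂ m = inj₂ (lift m)
    ... | inj₁ (av , v≥3) with v Fin.≟ w | w-status
    ...   | yes refl | inj₁ w≤2 = contradiction (≤-trans v≥3 w≤2) λ { (s≤s (s≤s ())) }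
    ...   | yes refl | inj₂ m   = inj₂ m
    ...   | no  v≢w  | _        =
      inj₁ (trans (alive-∷ʳ-other cur h≢v) av , subst (3 ≤_) (sym (degAfter-other av v≢w)) v≥3)
      where
      h≢v : h ≢ v
      h≢v refl = contradiction (≤-trans v≥3 (≤-reflexive (proj₂ r))) λ { (s≤s ()) }

    inv-advance : ∀ {M} → Inv cur M → degAfter cur w ≡ 2 → Rooted (cur ∷ʳ h) h → Inv (cur ∷ʳ h) M
    inv-advance inv w≡2 root-h = record
      { reduces       = reduces-∷ʳ {cur} {h} (I.reduces inv) r
      ; within        = connectedWithin-∷ʳ {cur} {h} (I.within inv) r
      ; leaves-intact = leaves-∷ʳ inv (≤-reflexive (sym w≡2))
      ; rooted        = rooted-∷ʳ inv root-h
      ; recorded      = λ m → occurs-∷ʳ {xs = cur} {a = h} (I.recorded inv m)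
      ; distinct      = I.distinct inv
      ; accounted     = accounted-∷ʳ inv id (inj₁ (≤-reflexive w≡2))
      }

    goodMatch : ∀ {x} → deg G x ≡ 1 → 3 ≤ degAfter cur w → Match
    goodMatch {x} dx w≥3 = record
      { leaf = x ; leaf-deg = dx ; before = cur ; deleted = h ; target = w
      ; target-alive = w-alive ; target-adj = hw ; target-deg = w≥3 }

    inv-good : ∀ {M x} → Inv cur M → (dx : deg G x ≡ 1) (w≥3 : 3 ≤ degAfter cur w) →
      Rooted (cur ∷ʳ h) h → Inv (cur ∷ʳ h) (goodMatch dx w≥3 ∷ M)
    inv-good {M} inv dx w≥3 root-h = record
      { reduces       = reduces-∷ʳ {cur} {h} (I.reduces inv) r
      ; within        = connectedWithin-∷ʳ {cur} {h} (I.within inv) r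
      ; leaves-intact = leaves-∷ʳ inv (≤-trans (n≤1+n 2) w≥3)
      ; rooted        = rooted-∷ʳ inv root-h
      ; recorded      = recorded
      ; distinct      = distinct
      ; accounted     = accounted-∷ʳ {M′ = e₀ ∷ M} inv there (inj₂ (here refl))
      }
      where
      e₀ = goodMatch dx w≥3

      recorded : ∀ {e} → e ∈ e₀ ∷ M → Occurs (before e) (deleted e) (cur ∷ʳ h)
      recorded (here refl) = occurs-last cur
      recorded (there m)   = occurs-∷ʳ (I.recorded inv m)

      older : ∀ {e} → e ∈ M → before e ≢ cur
      older m eq = <-irrefl (cong length eq) (occurs-length (I.recorded inv m))

      distinct : ∀ {e₁ e₂} → e₁ ∈ e₀ ∷ M → e₂ ∈ e₀ ∷ M → before e₁ ≡ before e₂ → leaf e₁ ≡ leaf e₂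
      distinct (here refl) (here refl) _  = refl
      distinct (here refl) (there m₂)  eq = contradiction (sym eq) (older m₂)
      distinct (there m₁)  (here refl) eq = contradiction eq (older m₁)
      distinct (there m₁)  (there m₂)  eq = I.distinct inv m₁ m₂ eq

  -- The walk from one leaf

  module Walk {pre₀ M} (inv₀ : Inv pre₀ M) (settled₀ : DeadLeavesSettled pre₀ M)
              {x} (x-leaf : deg G x ≡ 1) (x-alive : alive pre₀ x ≡ true) where

    record Outcome : Set where
      field
        pre       : List (Fin n)
        matches   : List Match
        inv       : Inv pre matches
        settled   : DeadLeavesSettled pre matches
        settled-x : Settled matches x
        lift      : ∀ {v} → Settled M v → Settled matches v
        grows     : length matches ≤ suc (length M)

    -- The walk from x has deleted a path x = h₀, h₁, …, hₖ₋₁ and now stands at h = hₖ.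
    record Position (cur : List (Fin n)) (h : Fin n) : Set where
      field
        inv       : Inv cur M
        reduction : IsOneReduction cur h
        inner     : h ≡ x ⊎ 2 ≤ deg G h
        reaches   : Connected G x h
        x-gone    : x ≡ h ⊎ alive cur x ≡ false
        untouched : ∀ v → alive cur v ≡ true → v ≢ h → degAfter cur v ≡ degAfter pre₀ v
        deletedLeaves : ∀ v → deg G v ≡ 1 → alive cur v ≡ false → alive pre₀ v ≡ false ⊎ v ≡ x

    start : Position pre₀ x
    start = record
      { inv       = inv₀
      ; reduction = x-alive , Inv.leaves-intact inv₀ x x-leaf x-alive
      ; inner     = inj₁ refl
      ; reaches   = here
      ; x-gone    = inj₁ refl
      ; untouched = λ _ _ _ → refl
      ; deletedLeaves = λ v _ dead → inj₁ dead
      }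

    conclude : ∀ {pre M′} → Inv pre M′ → (∀ {v} → Settled M v → Settled M′ v) → Settled M′ x →
      (∀ v → deg G v ≡ 1 → alive pre v ≡ false → alive pre₀ v ≡ false ⊎ v ≡ x) →
      length M′ ≤ suc (length M) → Outcome
    conclude {pre} {M′} inv lift settled-x deletedLeaves grows = record
      { pre = pre ; matches = M′ ; inv = inv ; settled = settled ; settled-x = settled-x
      ; lift = lift ; grows = grows }
      where
      settled : DeadLeavesSettled pre M′
      settled v dv dead with deletedLeaves v dv dead
      ... | inj₁ dead₀ = lift (settled₀ v dv dead₀)
      ... | inj₂ refl  = settled-x

    module Step {cur h} (pos : Position cur h) {w} (w-alive : alive cur w ≡ true)
                (hw : adj G h w ≡ true) where
      open Position pos
      open LeafDeletion {cur} {h} {w} reduction w-alive hw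

      w-reached : 1 ≤ degAfter cur w
      w-reached = degIn-pos (alive cur) (proj₁ reduction) (adj-sym′ hw)

      shrinks : aliveCount cur ≡ suc (aliveCount (cur ∷ʳ h))
      shrinks = aliveCount-∷ʳ cur (proj₁ reduction)

      x-dead : alive (cur ∷ʳ h) x ≡ false
      x-dead with x-gone
      ... | inj₁ x≡h  = subst (λ z → alive (cur ∷ʳ h) z ≡ false) (sym x≡h) (alive-∷ʳ-self cur h)
      ... | inj₂ dead = dead-∷ʳ cur dead

      root-h : Rooted (cur ∷ʳ h) h
      root-h = x , x-leaf , x-dead , reaches

      deletedLeaves-∷ʳ : ∀ v → deg G v ≡ 1 → alive (cur ∷ʳ h) v ≡ false → alive pre₀ v ≡ false ⊎ v ≡ x
      deletedLeaves-∷ʳ v dv dead with dead-∷ʳ⁻ cur dead | inner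
      ... | inj₂ dead′ | _          = deletedLeaves v dv dead′
      ... | inj₁ v≡h   | inj₁ h≡x   = inj₂ (trans v≡h h≡x)
      ... | inj₁ refl  | inj₂ h≥2   = contradiction (≤-trans h≥2 (≤-reflexive dv)) λ { (s≤s ()) }

      -- If w has other neighbours they were deleted before the walk started, hence are rooted at
      -- leaves other than x.
      otherLeaf : degAfter cur w ≡ 1 → Σ (Fin n) λ y → (y ≢ x) × (deg G y ≡ 1) × Connected G x y
      otherLeaf w≡1 with deg G w ≟ 1
      ... | yes dw = w , w≢x , dw , Connected-trans reaches (step hw here)
        where
        w≢x : w ≢ x
        w≢x w≡x with x-gone
        ... | inj₁ x≡h  = w≢h (trans w≡x x≡h)
        ... | inj₂ dead = false-true-≢ {S = alive cur} dead w-alive (sym w≡x)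
      ... | no ¬dw =
        let q , wq , dead-q   = degIn-missing (alive pre₀) w (λ eq → ¬dw (trans (sym eq) w₀≡1))
            z , dz , dead-z , zq = Inv.rooted inv₀ q dead-q
        in z , (λ z≡x → false-true-≢ {S = alive pre₀} dead-z x-alive z≡x) , dz ,
           Connected-trans reaches (step hw (step wq (Connected-sym zq)))
        where
        w₀≡1 : degAfter pre₀ w ≡ 1
        w₀≡1 = trans (sym (untouched w w-alive w≢h)) w≡1

      -- h – w is now a whole component, so nothing connected to x still has degree ≥ 3.
      cover : degAfter cur w ≡ 1 → ∀ v → Connected G x v → 3 ≤ deg G v → v ∈ map target M
      cover w≡1 v xv v≥3 with Inv.accounted inv v v≥3
      ... | inj₂ m = m
      ... | inj₁ (av , deg≥3)
        with isolated-edge cur (proj₁ reduction) w-alive hw (proj₂ reduction) w≡1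
               (Inv.within inv (proj₁ reduction) av (Connected-trans (Connected-sym reaches) xv))
      ...   | inj₁ refl = contradiction (≤-trans deg≥3 (≤-reflexive (proj₂ reduction))) λ { (s≤s ()) }
      ...   | inj₂ refl = contradiction (≤-trans deg≥3 (≤-reflexive w≡1)) λ { (s≤s ()) }

      abandon : degAfter cur w ≡ 1 → Outcome
      abandon w≡1 = conclude inv id (inj₂ (otherLeaf w≡1 , cover w≡1)) deletedLeaves (n≤1+n _)

      advance : degAfter cur w ≡ 2 → Position (cur ∷ʳ h) w
      advance w≡2 = record
        { inv       = inv-advance inv w≡2 root-h
        ; reduction = alive-w , suc-injective (trans (sym degAfter-w) w≡2)
        ; inner     = inj₂ (≤-trans (≤-reflexive (sym w≡2)) (degIn-≤-deg _ w))
        ; reaches   = Connected-trans reaches (step hw here)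
        ; x-gone    = inj₂ x-dead
        ; untouched = λ v av v≢w → let av′ , h≢v = alive-∷ʳ⁻ cur av in
                        trans (degAfter-other av′ v≢w) (untouched v av′ (h≢v ∘ sym))
        ; deletedLeaves = deletedLeaves-∷ʳ
        }

      good : 3 ≤ degAfter cur w → Outcome
      good w≥3 = conclude (inv-good inv x-leaf w≥3 root-h) (settled-∷ _) (inj₁ (here refl)) deletedLeaves-∷ʳ ≤-refl

    next : ∀ {cur h} → Position cur h → ∃ λ w → (alive cur w ≡ true) × (adj G h w ≡ true)
    next {cur} {h} pos = degIn-neighbour (alive cur) h (≤-reflexive (sym (proj₂ (Position.reduction pos))))

    walk : ∀ k {cur h} → aliveCount cur ≡ k → Position cur h → Outcome
    walk zero    {cur} count pos =
      contradiction (≤-trans (aliveCount-pos cur (proj₁ (Position.reduction pos))) (≤-reflexive count)) λ ()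
    walk (suc k) {cur} count pos with w , w-alive , hw ← next pos with degAfter cur w in w-deg
    ... | zero              = contradiction (≤-trans (Step.w-reached pos w-alive hw) (≤-reflexive w-deg)) λ ()
    ... | suc zero          = Step.abandon pos w-alive hw w-deg
    ... | suc (suc zero)    = walk k (suc-injective (trans (sym (Step.shrinks pos w-alive hw)) count))
                                     (Step.advance pos w-alive hw w-deg)
    ... | suc (suc (suc _)) =
      Step.good pos w-alive hw (≤-trans (s≤s (s≤s (s≤s z≤n))) (≤-reflexive (sym w-deg)))

    outcome : Outcome
    outcome = walk _ refl start

  -- Processing all leaves

  leaves : List (Fin n)
  leaves = filter (λ v → deg G v ≟ 1) (allFin n)

  record Run (bound : ℕ) : Set where
    field
      vs      : List (Fin n)
      matches : List Match
      inv     : Inv vs matches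
      settled : ∀ x → deg G x ≡ 1 → Settled matches x
      few     : length matches ≤ bound

  run-weaken : ∀ {a b} → a ≤ b → Run a → Run b
  run-weaken a≤b r = record { Run r ; few = ≤-trans (Run.few r) a≤b }

  Pending : List (Fin n) → List Match → Set
  Pending xs M = ∀ y → deg G y ≡ 1 → y ∈ xs ⊎ Settled M y

  pending-∷ : ∀ {x xs M M′} → Settled M′ x → (∀ {v} → Settled M v → Settled M′ v) →
    Pending (x ∷ xs) M → Pending xs M′
  pending-∷ settled-x lift pending y dy with pending y dy
  ... | inj₁ (here refl) = inj₂ settled-x
  ... | inj₁ (there y∈)  = inj₁ y∈
  ... | inj₂ settled-y   = inj₂ (lift settled-y)

  process : ∀ xs → All (λ x → deg G x ≡ 1) xs → ∀ {pre M} → Inv pre M → DeadLeavesSettled pre M →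
    Pending xs M → Run (length M + length xs)
  process [] [] {pre} {M} inv _ pending = record
    { vs = pre ; matches = M ; inv = inv
    ; settled = λ x dx → fromInj₂ (λ ()) (pending x dx)
    ; few = ≤-reflexive (sym (+-identityʳ _)) }
  process (x ∷ xs) (dx ∷ dxs) {pre} {M} inv dead pending with alive pre x in ax
  ... | false = run-weaken (+-monoʳ-≤ (length M) (n≤1+n _))
                  (process xs dxs inv dead (pending-∷ (dead x dx ax) id pending))
  ... | true  = run-weaken (≤-trans (+-monoˡ-≤ (length xs) grows) (≤-reflexive (sym (+-suc _ _))))
                  (process xs dxs inv′ settled (pending-∷ settled-x lift pending))
    where open Walk.Outcome (Walk.outcome inv dead dx ax) renaming (inv to inv′)

  run : Run (numDeg G 1)
  run = process leaves (all-filter (λ v → deg G v ≟ 1) (allFin n)) inv-[] (λ _ _ ())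
          (λ x dx → inj₁ (∈-filter⁺ (λ v → deg G v ≟ 1) (∈-allFin x) dx))

  module Construction where
    open Run run public

    position : ∀ {e} → e ∈ matches →
      Σ (Fin (length vs)) λ i → (take (toℕ i) vs ≡ before e) × (lookup vs i ≡ deleted e)
    position m = occurs-index (Inv.recorded inv m)

    positionOf : ∀ {x} → MatchedIn matches x → Fin (length vs)
    positionOf m = proj₁ (position (proj₁ (proj₂ (find m))))

    match : Fin n → Maybe (Fin (length vs))
    match x with any? (λ e → leaf e Fin.≟ x) matches
    ... | yes m = just (positionOf m)
    ... | no  _ = nothing

    match-just : ∀ {x i} → match x ≡ just i → Σ (MatchedIn matches x) λ m → positionOf m ≡ i
    match-just {x} eq with any? (λ e → leaf e Fin.≟ x) matches
    match-just     eq | yes m = m , just-injective eq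
    match-just     () | no  _

    match-nothing : ∀ {x} → match x ≡ nothing → ¬ MatchedIn matches x
    match-nothing {x} eq with any? (λ e → leaf e Fin.≟ x) matches
    match-nothing     () | yes _
    match-nothing     eq | no ¬m = ¬m

    good-at : ∀ {e} (m : e ∈ matches) → GoodAt G vs (proj₁ (position m))
    good-at {e} m =
      let _ , take≡ , lookup≡ = position m in
      target e ,
      subst (λ p → alive p (target e) ≡ true) (sym take≡) (target-alive e) ,
      subst (λ c → adj G c (target e) ≡ true) (sym lookup≡) (target-adj e) ,
      subst (λ p → 3 ≤ degAfter p (target e)) (sym take≡) (target-deg e)

    match-good : ∀ x i → match x ≡ just i → (deg G x ≡ 1) × GoodAt G vs i
    match-good x i eq =
      let m , i≡ = match-just eq
          e , e∈ , leaf≡x = find m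
      in subst (λ z → deg G z ≡ 1) leaf≡x (leaf-deg e) , subst (GoodAt G vs) i≡ (good-at e∈)

    match-injective : ∀ x y i → match x ≡ just i → match y ≡ just i → x ≡ y
    match-injective x y i eqx eqy =
      let m₁ , i≡₁ = match-just eqx
          m₂ , i≡₂ = match-just eqy
          e₁ , e₁∈ , leaf≡x = find m₁
          e₂ , e₂∈ , leaf≡y = find m₂
          before≡ = begin
            before e₁                      ≡⟨ proj₁ (proj₂ (position e₁∈)) ⟨
            take (toℕ (positionOf m₁)) vs  ≡⟨ cong (λ i → take (toℕ i) vs) (trans i≡₁ (sym i≡₂)) ⟩
            take (toℕ (positionOf m₂)) vs  ≡⟨ proj₁ (proj₂ (position e₂∈)) ⟩
            before e₂                      ∎
      in trans (sym leaf≡x) (trans (Inv.distinct inv e₁∈ e₂∈ before≡) leaf≡y)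
      where open ≡-Reasoning

    abandoned : ∀ {x} → deg G x ≡ 1 → match x ≡ nothing → Abandoned matches x
    abandoned {x} dx eq with settled x dx
    ... | inj₁ m = contradiction m (match-nothing eq)
    ... | inj₂ a = a

    -- An unmatched leaf is Abandoned, so the vertices of degree ≥ 3 in its component are targets.
    U : List (Fin n)
    U = leaves ++ filter (λ v → deg G v ≟ 2) (allFin n) ++ map target matches

    U-covers : ∀ v x → deg G x ≡ 1 → match x ≡ nothing → Connected G x v → v ∈ U
    U-covers v x dx eq xv with deg G v ≟ 1 | deg G v ≟ 2
    ... | yes d1 | _      = ∈-++⁺ˡ (∈-filter⁺ _ (∈-allFin v) d1)
    ... | no  _  | yes d2 = ∈-++⁺ʳ leaves (∈-++⁺ˡ (∈-filter⁺ _ (∈-allFin v) d2))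
    ... | no ¬d1 | no ¬d2 = ∈-++⁺ʳ leaves (∈-++⁺ʳ _ (proj₂ (abandoned dx eq) v xv v≥3))
      where
      v≥3 : 3 ≤ deg G v
      v≥3 = ≤∧≢⇒< (≤∧≢⇒< (Connected-deg-pos xv (≤-reflexive (sym dx))) (¬d1 ∘ sym)) (¬d2 ∘ sym)

    U-small : length U ≤ 2 * numDeg G 1 + numDeg G 2
    U-small = begin
      length U                                 ≡⟨ length-++ leaves ⟩
      k + length (L₂ ++ map target matches)    ≡⟨ cong (k +_) (length-++ L₂) ⟩
      k + (k₂ + length (map target matches))   ≡⟨ cong (λ m → k + (k₂ + m)) (length-map target matches) ⟩
      k + (k₂ + length matches)                ≤⟨ +-monoʳ-≤ k (+-monoʳ-≤ k₂ few) ⟩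
      k + (k₂ + k)                             ≡⟨ cong (k +_) (+-comm k₂ k) ⟩
      k + (k + k₂)                             ≡⟨ sym (+-assoc k k k₂) ⟩
      k + k + k₂                               ≡⟨ cong (λ m → k + m + k₂) (sym (+-identityʳ k)) ⟩
      2 * k + k₂                               ∎
      where
      open ≤-Reasoning
      k  = numDeg G 1
      k₂ = numDeg G 2
      L₂ = filter (λ v → deg G v ≟ 2) (allFin n)

mainTheorem7 : ∀ (n : ℕ) (G : Graph n) →
    Σ (List (Fin n)) λ vs → IsReductionSeq G vs ×
      Σ (Fin n → Maybe (Fin (length vs))) λ match →
        (∀ x i → match x ≡ just i → (deg G x ≡ 1) × GoodAt G vs i) ×
        (∀ x y i → match x ≡ just i → match y ≡ just i → x ≡ y) ×
        (∀ x → deg G x ≡ 1 → match x ≡ nothing →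
          Σ (Fin n) λ y → (¬ (y ≡ x)) × (deg G y ≡ 1) × Connected G x y) ×
        Σ (List (Fin n)) λ U →
          (∀ v x → deg G x ≡ 1 → match x ≡ nothing → Connected G x v → v ∈ U) ×
          (length U ≤ 2 * numDeg G 1 + numDeg G 2)
mainTheorem7 n G =
  vs , reduces⇒isReductionSeq G (Inv.reduces inv) ,
  match , match-good , match-injective , (λ x dx eq → proj₁ (abandoned dx eq)) ,
  U , U-covers , U-small
  where open Construction G
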